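{- Let $q\ge 2$ and let $M$ be the star matrix of a partition of ${\bf Z}_q^n$ into subcubes all of the same dimension. Let $T$ be a transfractal in $M$ with row set $I$ and column set $J$, let $t\in J$ and let $s\notin J$ be a column of $M$. Then either the columns $t$ and $s$ do not overlap, or $t$ is inserted into $s$; and in the latter case there is a single $a\in{\bf Z}_q$ such that $M_{r,s}=a$ for every row $r$ with $M_{r,t}\in{\bf Z}_q$.
   Context: A subcube of ${\bf Z}_q^n$ is a set obtained by fixing some coordinates to given elements of ${\bf Z}_q$ and letting the others run over ${\bf Z}_q$; its dimension is the number of free coordinates; its star pattern is the vector in $({\bf Z}_q\cup\{*\})^n$ with the fixed value at fixed coordinates and $*$ at free ones. The star matrix of a partition into subcubes has as rows the star patterns of the subcubes. The overlap of two columns is the set of rows in which both columns contain elements of ${\bf Z}_q$ (numbers); the columns do not overlap if this set is empty; column $t$ is inserted into column $s$ if every row in which $t$ contains a number is a row in which $s$ contains a number. Fractal matrices: $M_{q,0}$ is the $1\times 0$ matrix; for $l\ge1$, $M_{q,l}$ is the $q^l\times\frac{q^l-1}{q-1}$ matrix whose rows are split into $q$ consecutive blocks $B_0,\dots,B_{q-1}$ of $q^{l-1}$ rows, whose first column equals $a$ on every row of $B_a$, and whose remaining columns are split into $q$ consecutive groups $G_0,\dots,G_{q-1}$ of $\frac{q^{l-1}-1}{q-1}$ columns each, where the submatrix on $B_a\times G_a$ is $M_{q,l-1}$ and on $B_a\times G_b$, $b\ne a$, consists only of $*$. A matrix is fractal if obtained from some $M_{q,l}$ by permuting rows and columns. A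 submatrix $T$ of $M$ (row set $I$, column set $J$, not necessarily consecutive) is a transfractal if $T$ is fractal with $|I|=q^l$ for some $l\ge1$ and every column in $J$ has only $*$ in the rows not in $I$. -}

module Defs where

open import Data.Nat using (ℕ; zero; suc; _+_)
open import Data.Fin using (Fin; zero; suc; _≟_)
open import Data.Vec using (Vec; []; _∷_)
open import Data.Maybe using (Maybe; just; nothing)
open import Data.Unit using (⊤; tt)
open import Data.Empty using (⊥)
open import Data.Sum using (_⊎_; inj₁; inj₂)
open import Data.Product using (Σ; _×_; _,_; ∃)
open import Relation.Nullary using (¬_; yes; no)
open import Relation.Binary.PropositionalEquality using (_≡_)
open import Function.Definitions using (Injective)

-- An entry of a star matrix: `just a` is the number a ∈ Z_q, `nothing` is *.
Entry : ℕ → Set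
Entry q = Maybe (Fin q)

StarMatrix : ℕ → ℕ → ℕ → Set
StarMatrix q m n = Fin m → Fin n → Entry q

_∈cube_ : ∀ {q n} → (Fin n → Fin q) → (Fin n → Entry q) → Set
x ∈cube p = ∀ i a → p i ≡ just a → x i ≡ a

IsPartition : ∀ {q m n} → StarMatrix q m n → Set
IsPartition {q} {m} {n} M =
  (x : Fin n → Fin q) → Σ (Fin m) λ r → (x ∈cube M r) × (∀ r' → x ∈cube M r' → r' ≡ r)

dim : ∀ {q n} → (Fin n → Entry q) → ℕ
dim {n = zero} p = 0
dim {n = suc n} p with p zero
... | nothing = suc (dim (λ i → p (suc i)))
... | just _  = dim (λ i → p (suc i))

AllSameDim : ∀ {q m n} → StarMatrix q m n → Set
AllSameDim {m = m} M = Σ ℕ λ d → (r : Fin m) → dim (M r) ≡ d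

-- Column indices of the fractal matrix M_{q,l}, in the paper's order:
-- the first column, then the groups G_0, …, G_{q-1}, each a copy of the
-- columns of M_{q,l-1}.  (There are (q^l-1)/(q-1) of them.)
FCol : ℕ → ℕ → Set
FCol q zero    = ⊥
FCol q (suc l) = ⊤ ⊎ (Fin q × FCol q l)

-- Rows of M_{q,l} are indexed by Vec (Fin q) l in lexicographic order
-- (q^l of them): the block B_a consists of rows a ∷ v.
-- The fractal matrix M_{q,l}:
fractal : (q l : ℕ) → Vec (Fin q) l → FCol q l → Entry q
fractal q zero    []      ()
fractal q (suc l) (a ∷ v) (inj₁ tt)      = just a
fractal q (suc l) (a ∷ v) (inj₂ (b , c)) with a ≟ b
... | yes _ = fractal q l v c
... | no  _ = nothing

-- A transfractal in M: the submatrix with row set I = image of σ and column set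
-- J = image of τ (σ, τ injective) equals M_{q,l} up to these row/column
-- permutations, l ≥ 1, and every column of J has only * outside the rows of I.
record Transfractal {q m n : ℕ} (M : StarMatrix q m n) : Set where
  field
    l      : ℕ
    l≥1    : Σ ℕ λ k → l ≡ suc k
    σ      : Vec (Fin q) l → Fin m
    τ      : FCol q l → Fin n
    σ-inj  : Injective _≡_ _≡_ σ
    τ-inj  : Injective _≡_ _≡_ τ
    isFrac : ∀ v c → M (σ v) (τ c) ≡ fractal q l v c
    outside : ∀ c r → (∀ v → ¬ (σ v ≡ r)) → M r (τ c) ≡ nothing

_∈J_ : ∀ {q m n} {M : StarMatrix q m n} → Fin n → Transfractal M → Set
t ∈J T = Σ (FCol _ (Transfractal.l T)) λ c → Transfractal.τ T c ≡ t

IsNumber : ∀ {q} → Entry q → Set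
IsNumber e = Σ (Fin _) λ a → e ≡ just a

NoOverlap : ∀ {q m n} → StarMatrix q m n → Fin n → Fin n → Set
NoOverlap M t s = ∀ r → IsNumber (M r t) → ¬ IsNumber (M r s)

InsertedInto : ∀ {q m n} → StarMatrix q m n → Fin n → Fin n → Set
InsertedInto M t s = ∀ r → IsNumber (M r t) → IsNumber (M r s)

{-# OPTIONS --safe #-}
module Submission where

-- Fix a row σ w of the transfractal and a filler e for its stars.  Overwriting
-- the J-coordinates of the resulting point by the centre of another fractal row v
-- gives a point x whose subcube must be σ v: a row outside I has only * on J, so
-- it would also contain the unmodified point, which lies in σ w; a row σ u of I
-- forces u = v because the rows of a fractal matrix are disjoint.  Since s ∉ J,
-- x agrees with row σ w at s, so a number a in M (σ v) s pins M (σ w) s down to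
-- a whatever the filler; hence column s is constant on I, and every number of
-- column t lies in a row of I.  The subcubes need not have equal dimension.

open import Defs
open import Data.Nat using (ℕ; _≥_; zero; suc; s≤s; z≤n)
open import Data.Fin using (Fin; zero; suc; _≟_; punchIn)
open import Data.Fin.Properties using (any?; punchInᵢ≢i)
open import Data.Vec using (Vec; []; _∷_; replicate)
open import Data.Maybe using (just; nothing; fromMaybe)
open import Data.Maybe.Properties using (just-injective; ≡-dec)
open import Data.Unit using (tt)
open import Data.Empty using (⊥-elim)
open import Data.Product using (Σ; ∃; _×_; _,_)
open import Data.Sum using (_⊎_; inj₁; inj₂)
open import Relation.Nullary using (¬_; Dec; yes; no)
open import Relation.Nullary.Decidable using (decidable-stable)
open import Relation.Unary using (Decidable)
open import Relation.Binary.PropositionalEquality using (_≡_; _≢_; refl; sym; trans; cong; subst)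

any-FCol? : ∀ {q} l {P : FCol q l → Set} → Decidable P → Dec (∃ P)
any-FCol? zero    P? = no λ ()
any-FCol? (suc l) P? with P? (inj₁ tt) | any? (λ b → any-FCol? l (λ c → P? (inj₂ (b , c))))
... | yes p  | _               = yes (inj₁ tt , p)
... | no _   | yes (b , c , p) = yes (inj₂ (b , c) , p)
... | no ¬p  | no ¬q           = no λ { (inj₁ tt , p) → ¬p p ; (inj₂ (b , c) , p) → ¬q (b , c , p) }

_∈fractalRow_ : ∀ {q l} → (FCol q l → Fin q) → Vec (Fin q) l → Set
_∈fractalRow_ {q} {l} y v = ∀ c b → fractal q l v c ≡ just b → y c ≡ b

fractalCentre : ∀ {q l} → Vec (Fin q) l → FCol q l → Fin q
fractalCentre (a ∷ v) (inj₁ tt)      = a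
fractalCentre (a ∷ v) (inj₂ (_ , c)) = fractalCentre v c

fractalCentre∈fractalRow : ∀ {q l} (v : Vec (Fin q) l) → fractalCentre v ∈fractalRow v
fractalCentre∈fractalRow (a ∷ v) (inj₁ tt)      b eq = just-injective eq
fractalCentre∈fractalRow (a ∷ v) (inj₂ (a' , c)) b eq with a ≟ a'
... | yes _ = fractalCentre∈fractalRow v c b eq
fractalCentre∈fractalRow (a ∷ v) (inj₂ (a' , c)) b () | no _

fractal-diagonal : ∀ {q l} (a : Fin q) v c → fractal q (suc l) (a ∷ v) (inj₂ (a , c)) ≡ fractal q l v c
fractal-diagonal a v c with a ≟ a
... | yes _  = refl
... | no a≢a = ⊥-elim (a≢a refl)

∈fractalRow-unique : ∀ {q l} {v w : Vec (Fin q) l} {y : FCol q l → Fin q} →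
                     y ∈fractalRow v → y ∈fractalRow w → v ≡ w
∈fractalRow-unique {v = []}    {[]}     _  _  = refl
∈fractalRow-unique {v = a ∷ v} {a' ∷ w} {y} yv yw
  with trans (sym (yv (inj₁ tt) a refl)) (yw (inj₁ tt) a' refl)
... | refl = cong (a ∷_) (∈fractalRow-unique (diagonal v yv) (diagonal w yw))
  where
    diagonal : ∀ u → y ∈fractalRow (a ∷ u) → (λ c → y (inj₂ (a , c))) ∈fractalRow u
    diagonal u yu c b eq = yu (inj₂ (a , c)) b (trans (fractal-diagonal a u c) eq)

other-than : ∀ {q} → q ≥ 2 → (a : Fin q) → ∃ λ e → e ≢ a
other-than (s≤s (s≤s z≤n)) a = punchIn a zero , punchInᵢ≢i a zero

dichotomy-of-constant-entry : ∀ {q m n} {M : StarMatrix q m n} {t s} (x : Entry q) →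
  (∀ r → IsNumber (M r t) → M r s ≡ x) →
  NoOverlap M t s ⊎ (InsertedInto M t s × Σ (Fin q) (λ a → ∀ r → IsNumber (M r t) → M r s ≡ just a))
dichotomy-of-constant-entry {M = M} {t} {s} nothing  same = inj₁ no-overlap
  where
    no-overlap : NoOverlap M t s
    no-overlap r rt (b , rs) with trans (sym rs) (same r rt)
    ... | ()
dichotomy-of-constant-entry (just a) same = inj₂ ((λ r rt → a , same r rt) , a , same)

module _ {q m n} {M : StarMatrix q m n} (T : Transfractal M) where
  open Transfractal T

  J-support⊆I : ∀ {t r} → t ∈J T → IsNumber (M r t) → ¬ (∀ v → σ v ≢ r)
  J-support⊆I {r = r} (c , refl) (b , rt) r∉I with trans (sym rt) (outside c r r∉I)
  ... | ()

  splice : Fin q → Fin m → (FCol q l → Fin q) → Fin n → Fin q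
  splice e r y i with any-FCol? l (λ c → τ c ≟ i)
  ... | yes (c , _) = y c
  ... | no _        = fromMaybe e (M r i)

  splice-J : ∀ e r y c → splice e r y (τ c) ≡ y c
  splice-J e r y c with any-FCol? l (λ c' → τ c' ≟ τ c)
  ... | yes (c' , τc'≡τc) = cong y (τ-inj τc'≡τc)
  ... | no c∉J            = ⊥-elim (c∉J (c , refl))

  splice-∉J : ∀ e r y {i} → ¬ i ∈J T → splice e r y i ≡ fromMaybe e (M r i)
  splice-∉J e r y {i} i∉J with any-FCol? l (λ c → τ c ≟ i)
  ... | yes i∈J = ⊥-elim (i∉J i∈J)
  ... | no _    = refl

  splice-centre-∈cube : ∀ e w → splice e (σ w) (fractalCentre w) ∈cube M (σ w)
  splice-centre-∈cube e w i b eq with any-FCol? l (λ c → τ c ≟ i)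
  ... | yes (c , refl) = fractalCentre∈fractalRow w c b (trans (sym (isFrac w c)) eq)
  ... | no _           = cong (fromMaybe e) eq

  module _ (partition : IsPartition M) where

    splice-∈cube-row : ∀ e v w → splice e (σ w) (fractalCentre v) ∈cube M (σ v)
    splice-∈cube-row e v w with partition (splice e (σ w) (fractalCentre v))
    ... | r , x∈r , _ = subst (λ r → x ∈cube M r) (decidable-stable (r ≟ σ v) r≡σv) x∈r
      where
        x x' : Fin n → Fin q
        x  = splice e (σ w) (fractalCentre v)
        x' = splice e (σ w) (fractalCentre w)

        x'∈r : (∀ u → σ u ≢ r) → x' ∈cube M r
        x'∈r r∉I i b eq with any-FCol? l (λ c → τ c ≟ i)
        ... | yes (c , refl) with trans (sym eq) (outside c r r∉I)
        ...   | ()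
        x'∈r r∉I i b eq | no i∉J = trans (sym (splice-∉J e (σ w) (fractalCentre v) i∉J)) (x∈r i b eq)

        r∈I : ¬ (∀ u → σ u ≢ r)
        r∈I r∉I with partition x'
        ... | _ , _ , unique = r∉I w (trans (unique (σ w) (splice-centre-∈cube e w))
                                            (sym (unique r (x'∈r r∉I))))

        row-of-I-is-σv : ∀ u → σ u ≡ r → r ≡ σ v
        row-of-I-is-σv u refl = cong σ (∈fractalRow-unique onRow-u onRow-v)
          where
            onRow-u : (λ c → x (τ c)) ∈fractalRow u
            onRow-u c b eq = x∈r (τ c) b (trans (isFrac u c) eq)
            onRow-v : (λ c → x (τ c)) ∈fractalRow v
            onRow-v c b eq = trans (splice-J e (σ w) (fractalCentre v) c)
                                   (fractalCentre∈fractalRow v c b eq)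

        r≡σv : ¬ ¬ (r ≡ σ v)
        r≡σv r≢σv = r∈I λ u σu≡r → r≢σv (row-of-I-is-σv u σu≡r)

    module _ (q≥2 : q ≥ 2) {s : Fin n} (s∉J : ¬ s ∈J T) where

      filled-entry : ∀ e v w {a} → M (σ v) s ≡ just a → fromMaybe e (M (σ w) s) ≡ a
      filled-entry e v w {a} σv-s = trans (sym (splice-∉J e (σ w) (fractalCentre v) s∉J))
                                          (splice-∈cube-row e v w s a σv-s)

      number-propagates : ∀ v w {a} → M (σ v) s ≡ just a → M (σ w) s ≡ just a
      number-propagates v w {a} σv-s with M (σ w) s | (λ e → filled-entry e v w σv-s)
      ... | just b  | filled = cong just (filled b)
      ... | nothing | filled with other-than q≥2 a
      ...   | e , e≢a = ⊥-elim (e≢a (filled e))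

      s-constant-on-I : ∀ u v → M (σ u) s ≡ M (σ v) s
      s-constant-on-I u v with M (σ u) s in σu-s | M (σ v) s in σv-s
      ... | just a  | _       = trans (sym (number-propagates u v σu-s)) σv-s
      ... | nothing | nothing = refl
      ... | nothing | just b  = trans (sym σu-s) (number-propagates v u σv-s)

      J-support-s-entry : ∀ {t r} v → t ∈J T → IsNumber (M r t) → M r s ≡ M (σ v) s
      J-support-s-entry {r = r} v t∈J rt =
        decidable-stable (≡-dec _≟_ (M r s) (M (σ v) s)) λ ne →
          J-support⊆I t∈J rt λ { u refl → ne (s-constant-on-I u v) }

corollary1 : (q m n : ℕ) → q ≥ 2 → (M : StarMatrix q m n) →
    IsPartition M → AllSameDim M →
    (T : Transfractal M) → (t s : Fin n) → t ∈J T → ¬ (s ∈J T) →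
    NoOverlap M t s ⊎
      (InsertedInto M t s ×
        Σ (Fin q) (λ a → ∀ r → IsNumber (M r t) → M r s ≡ just a))
corollary1 q m n q≥2@(s≤s (s≤s z≤n)) M partition _ T t s t∈J s∉J =
  dichotomy-of-constant-entry {M = M} {t} {s} _ λ r →
    J-support-s-entry T partition q≥2 s∉J (replicate _ zero) t∈J
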